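{- Let $G$ be a graph with an edge clique cover $\mathcal{W}$. Every minimal triangulation $H$ of $G$ has a maximal clique $\Omega$ such that every connected component $C$ of $G\setminus\Omega$ satisfies $|\mathcal{W}[C]|\le|\mathcal{W}|/2$.
   Context: Graphs are finite, simple and undirected. An edge clique cover of $G$ is a collection $\mathcal{W}$ of cliques of $G$ with every edge having both endpoints in some member. For $X\subseteq V(G)$, $\mathcal{W}[X]=\{W\in\mathcal{W}:W\cap X\ne\emptyset\}$. A triangulation of $G$ is a chordal graph $H$ with $V(H)=V(G)$, $E(G)\subseteq E(H)$; it is minimal if no triangulation has a strictly smaller edge set. A maximal clique means an inclusion-maximal clique. -}

module Defs where

open import Data.Bool using (Bool; true; false)
open import Data.Nat using (ℕ; zero; suc; _+_; _*_; _∸_; _≤_; _<_)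
open import Data.Fin using (Fin)
open import Data.Fin.Subset using (Subset; _∈_; _∉_; _⊆_; _∩_; Nonempty)
open import Data.Fin.Subset.Properties using (nonempty?)
open import Data.List using (List; length; filter)
open import Data.List.Membership.Propositional using () renaming (_∈_ to _∈ˡ_)
open import Data.List.Relation.Unary.All using (All)
open import Data.List.Relation.Unary.Unique.Propositional using (Unique)
open import Data.Product using (Σ; ∃; ∃-syntax; _×_; _,_)
open import Relation.Binary.PropositionalEquality using (_≡_; _≢_)
open import Relation.Nullary using (¬_)

record Graph (n : ℕ) : Set where
  field
    adj    : Fin n → Fin n → Bool
    sym    : ∀ x y → adj x y ≡ adj y x
    irrefl : ∀ x → adj x x ≡ false
open Graph public

Edge : ∀ {n} → Graph n → Fin n → Fin n → Set
Edge G x y = adj G x y ≡ true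

IsClique : ∀ {n} → Graph n → Subset n → Set
IsClique G K = ∀ x y → x ∈ K → y ∈ K → x ≢ y → Edge G x y

IsMaximalClique : ∀ {n} → Graph n → Subset n → Set
IsMaximalClique G K = IsClique G K × (∀ K′ → IsClique G K′ → K ⊆ K′ → K′ ⊆ K)

IsEdgeCliqueCover : ∀ {n} → Graph n → List (Subset n) → Set
IsEdgeCliqueCover G 𝒲 =
  Unique 𝒲 × All (IsClique G) 𝒲 ×
  (∀ x y → Edge G x y → ∃[ W ] (W ∈ˡ 𝒲 × x ∈ W × y ∈ W))

IsCycle : ∀ {n} → Graph n → (k : ℕ) → (ℕ → Fin n) → Set
IsCycle G k c =
  (∀ i j → i < k → j < k → c i ≡ c j → i ≡ j) ×
  (∀ i → suc i < k → Edge G (c i) (c (suc i))) ×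
  Edge G (c (k ∸ 1)) (c 0)

-- A chord: an edge between two non-consecutive vertices of the cycle.
HasChord : ∀ {n} → Graph n → (k : ℕ) → (ℕ → Fin n) → Set
HasChord G k c =
  ∃[ i ] ∃[ j ] (2 + i ≤ j × j < k × ¬ (i ≡ 0 × suc j ≡ k) × Edge G (c i) (c j))

Chordal : ∀ {n} → Graph n → Set
Chordal G = ∀ k c → 4 ≤ k → IsCycle G k c → HasChord G k c

_⊆ᴱ_ : ∀ {n} → Graph n → Graph n → Set
G ⊆ᴱ H = ∀ x y → Edge G x y → Edge H x y

_⊂ᴱ_ : ∀ {n} → Graph n → Graph n → Set
G ⊂ᴱ H = G ⊆ᴱ H × ∃[ x ] ∃[ y ] (Edge H x y × ¬ Edge G x y)

IsTriangulation : ∀ {n} → Graph n → Graph n → Set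
IsTriangulation G H = Chordal H × G ⊆ᴱ H

IsMinimalTriangulation : ∀ {n} → Graph n → Graph n → Set
IsMinimalTriangulation G H =
  IsTriangulation G H × (∀ H′ → IsTriangulation G H′ → ¬ (H′ ⊂ᴱ H))

data Reach {n} (G : Graph n) (S : Subset n) (x : Fin n) : Fin n → Set where
  here : x ∈ S → Reach G S x x
  step : ∀ {y z} → Reach G S x y → Edge G y z → z ∈ S → Reach G S x z

IsComponentMinus : ∀ {n} → Graph n → Subset n → Subset n → Set
IsComponentMinus G Ω C =
  Nonempty C ×
  (∀ x → x ∈ C → x ∉ Ω) ×
  (∀ x y → x ∈ C → y ∈ C → Reach G C x y) ×
  (∀ x y → x ∈ C → y ∉ Ω → Edge G x y → y ∈ C)

restrict : ∀ {n} → List (Subset n) → Subset n → List (Subset n)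
restrict 𝒲 X = filter (λ W → nonempty? (W ∩ X)) 𝒲

module Submission where

-- Only chordality of H and E(G) ⊆ E(H) are needed.
--
-- Call a set heavy if it meets more than |𝒲|/2 members of 𝒲.  Two sets with
-- no common vertex and no H-edge between them are never both heavy, since
-- every member of 𝒲 is a clique of G ⊆ H.  Start from any maximal clique Ω of
-- H.  If a component D of H ∖ Ω is heavy, chordality yields v ∈ D adjacent to
-- every vertex of Ω with a neighbour in D (the ends of suitable induced paths
-- inside D; anything else closes a chordless cycle of length ≥ 4).  A maximal
-- clique Ω′ ⊇ {v} ∪ (N(v) ∩ Ω) separates D from the rest, so every heavy
-- component of H ∖ Ω′ is a proper subset of D.  Iterating, the heavy
-- component shrinks until none is left; finally each component of G ∖ Ω lies
-- in a component of H ∖ Ω.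

open import Defs
open import Data.Bool using (true)
open import Data.Bool.Properties using () renaming (_≟_ to _≟ᵇ_)
open import Data.Nat using (ℕ; zero; suc; _+_; _*_; _∸_; _≤_; _<_; z≤n; s≤s; _≤?_; _<?_)
open import Data.Nat.Properties
open import Data.Nat.Induction using (<-rec)
open import Data.Fin using (Fin) renaming (_≟_ to _≟ᶠ_)
open import Data.Fin.Properties using (any?; all?)
open import Data.Fin.Subset using (Subset; _∈_; _∉_; _⊆_; _⊂_; _∩_; _∪_; ⁅_⁆; ∣_∣; Nonempty; ⊥)
open import Data.Fin.Subset.Properties
  using (_∈?_; _⊆?_; _⊂?_; ⊆-antisym; p⊂q⇒∣p∣<∣q∣; ∣p∣≤n; x∈⁅x⁆; x∈⁅y⁆⇒x≡y; ∉⊥;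
         p⊆p∪q; q⊆p∪q; x∈p∪q⁻; x∈p∩q⁻; x∈p∩q⁺; nonempty?; x∉p⇒x∈∁p; x∈∁p⇒x∉p)
open import Data.Vec using (tabulate)
open import Data.Vec.Properties using (lookup∘tabulate; lookup⇒[]=; []=⇒lookup)
open import Data.List using (List; []; _∷_; length; allFin)
open import Data.List.Membership.Propositional using () renaming (_∈_ to _∈ˡ_)
open import Data.List.Membership.Propositional.Properties using (∈-allFin)
open import Data.List.Relation.Unary.All using () renaming (lookup to lookupAll)
open import Data.List.Relation.Unary.Any using (here; there)
open import Data.Product using (∃; ∃₂; ∃-syntax; _×_; _,_; proj₁; proj₂)
open import Data.Sum using (_⊎_; inj₁; inj₂)
open import Data.Empty using (⊥-elim) renaming (⊥ to Empty)
open import Relation.Binary.PropositionalEquality using (_≡_; _≢_; refl; trans; cong; subst) renaming (sym to ≡-sym)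
open import Relation.Nullary using (¬_; Dec; yes; no; does; contradiction)
open import Relation.Nullary.Decidable using (_×-dec_; _⊎-dec_; _→-dec_; ¬?)
open import Relation.Unary using (Decidable)
open import Function using (_∘_)
open import Relation.Binary.Definitions using (tri<; tri≈; tri>)

module Adjacency {n : ℕ} (H : Graph n) where

  E : Fin n → Fin n → Set
  E = Edge H

  E? : ∀ x y → Dec (E x y)
  E? x y = adj H x y ≟ᵇ true

  E-sym : ∀ {x y} → E x y → E y x
  E-sym {x} {y} e = trans (Graph.sym H y x) e

  E-irrefl : ∀ {x} → ¬ E x x
  E-irrefl {x} e with trans (≡-sym e) (irrefl H x)
  ... | ()

fromDec : ∀ {n} {P : Fin n → Set} → Decidable P → Subset n
fromDec P? = tabulate (λ x → does (P? x))

∈fromDec⁺ : ∀ {n} {P : Fin n → Set} (P? : Decidable P) {x} → P x → x ∈ fromDec P?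
∈fromDec⁺ P? {x} px with P? x in eq
... | yes _ = lookup⇒[]= x _ (trans (lookup∘tabulate _ x) (cong does eq))
... | no ¬p = contradiction px ¬p

∈fromDec⁻ : ∀ {n} {P : Fin n → Set} (P? : Decidable P) {x} → x ∈ fromDec P? → P x
∈fromDec⁻ P? {x} mem with P? x | trans (≡-sym (lookup∘tabulate (λ y → does (P? y)) x)) ([]=⇒lookup mem)
... | yes p | _ = p
... | no _ | ()

⊆∧⊉⇒⊂ : ∀ {n} {Y Z : Subset n} → Y ⊆ Z → ¬ (Z ⊆ Y) → Y ⊂ Z
⊆∧⊉⇒⊂ {Y = Y} {Z} Y⊆Z Z⊈Y with Y ⊂? Z
... | yes Y⊂Z = Y⊂Z
... | no Y⊄Z = ⊥-elim (Z⊈Y back)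
  where
    back : Z ⊆ Y
    back {x} x∈Z with x ∈? Y
    ... | yes x∈Y = x∈Y
    ... | no x∉Y = ⊥-elim (Y⊄Z (Y⊆Z , x , x∈Z , x∉Y))

lastWitness : ∀ {P : ℕ → Set} → (∀ i → Dec (P i)) → P 0 → ∀ k →
              ∃ λ i → i ≤ k × P i × (∀ j → i < j → j ≤ k → ¬ P j)
lastWitness P? P0 zero = 0 , z≤n , P0 , λ j 0<j j≤0 → ⊥-elim (<⇒≱ 0<j j≤0)
lastWitness P? P0 (suc k) with P? (suc k) | lastWitness P? P0 k
... | yes Pk | _ = suc k , ≤-refl , Pk , λ j k<j j≤k → ⊥-elim (<⇒≱ k<j j≤k)
... | no ¬Pk | i , i≤k , Pi , none = i , m≤n⇒m≤1+n i≤k , Pi , later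
  where
    later : ∀ j → i < j → j ≤ suc k → ¬ _
    later j i<j j≤1+k with m≤n⇒m<n∨m≡n j≤1+k
    ... | inj₁ j<1+k = none j i<j (≤-pred j<1+k)
    ... | inj₂ refl = ¬Pk

iter : ∀ {n} → (Subset n → Subset n) → Subset n → ℕ → Subset n
iter f X zero = X
iter f X (suc i) = f (iter f X i)

-- An inflationary operator on subsets of Fin n reaches a fixed point after n
-- steps: a strict increase is only possible n times.
module Saturation {n : ℕ} (f : Subset n → Subset n) (inflates : ∀ {Y} → Y ⊆ f Y) (X : Subset n) where

  Stuck : ℕ → Set
  Stuck j = f (iter f X j) ⊆ iter f X j

  iter-inflates : ∀ i → X ⊆ iter f X i
  iter-inflates zero x∈X = x∈X
  iter-inflates (suc i) x∈X = inflates (iter-inflates i x∈X)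

  iter-stays : ∀ j → Stuck j → ∀ k → iter f X (k + j) ≡ iter f X j
  iter-stays j stuck zero = refl
  iter-stays j stuck (suc k) = trans (cong f (iter-stays j stuck k)) (⊆-antisym stuck inflates)

  iter-grows : ∀ i → (∀ j → j < i → ¬ Stuck j) → ∀ j → j ≤ i → j ≤ ∣ iter f X j ∣
  iter-grows i moving zero _ = z≤n
  iter-grows i moving (suc j) j<i =
    <-≤-trans (s≤s (iter-grows i moving j (<⇒≤ j<i)))
              (p⊂q⇒∣p∣<∣q∣ (⊆∧⊉⇒⊂ inflates (moving j j<i)))

  -- Either the iteration is stuck at some j ≤ n, hence constant from there
  -- on, or it grows n + 1 times, exceeding the n available elements.
  saturated : Stuck n
  saturated with anyUpTo? (λ j → f (iter f X j) ⊆? iter f X j) (suc n)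
  ... | yes (j , s≤s j≤n , stuck) = subst (λ Y → f Y ⊆ Y) (≡-sym n≡j) stuck
    where
      n≡j : iter f X n ≡ iter f X j
      n≡j = trans (cong (iter f X) (≡-sym (m∸n+n≡m j≤n))) (iter-stays j stuck (n ∸ j))
  ... | no never = ⊥-elim (<⇒≱ (iter-grows (suc n) moving (suc n) ≤-refl) (∣p∣≤n (iter f X (suc n))))
    where
      moving : ∀ j → j < suc n → ¬ Stuck j
      moving j j<1+n stuck = never (j , j<1+n , stuck)

module Walks {n : ℕ} (H : Graph n) where
  open Adjacency H

  record IsWalk (X : Subset n) (p : ℕ → Fin n) (k : ℕ) : Set where
    field
      inside : ∀ i → i ≤ k → p i ∈ X
      steps  : ∀ i → i < k → E (p i) (p (suc i))
  open IsWalk public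

  record Walk (X : Subset n) (x y : Fin n) : Set where
    field
      len    : ℕ
      vertex : ℕ → Fin n
      isWalk : IsWalk X vertex len
      start  : vertex 0 ≡ x
      end    : vertex len ≡ y
  open Walk public

  walk-mono : ∀ {X Y p k} → X ⊆ Y → IsWalk X p k → IsWalk Y p k
  walk-mono X⊆Y w = record { inside = λ i i≤k → X⊆Y (inside w i i≤k) ; steps = steps w }

  walk-prefix : ∀ {X p k j} → j ≤ k → IsWalk X p k → IsWalk X p j
  walk-prefix j≤k w = record
    { inside = λ i i≤j → inside w i (≤-trans i≤j j≤k)
    ; steps  = λ i i<j → steps w i (<-≤-trans i<j j≤k) }

  walk-suffix : ∀ {X p} i {L} → IsWalk X p (i + L) → IsWalk X (λ j → p (i + j)) L
  walk-suffix {p = p} i w = record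
    { inside = λ j j≤L → inside w (i + j) (+-monoʳ-≤ i j≤L)
    ; steps  = λ j j<L → subst (λ m → E (p (i + j)) (p m)) (≡-sym (+-suc i j))
                               (steps w (i + j) (+-monoʳ-< i j<L)) }

  append : (ℕ → Fin n) → ℕ → Fin n → ℕ → Fin n
  append p k y i with i ≤? k
  ... | yes _ = p i
  ... | no _ = y

  append-old : ∀ p k y i → i ≤ k → append p k y i ≡ p i
  append-old p k y i i≤k with i ≤? k
  ... | yes _ = refl
  ... | no i≰k = contradiction i≤k i≰k

  append-new : ∀ p k y → append p k y (suc k) ≡ y
  append-new p k y with suc k ≤? k
  ... | yes 1+k≤k = contradiction 1+k≤k (n≮n k)
  ... | no _ = refl

  walk-append : ∀ {X p k y} → IsWalk X p k → E (p k) y → y ∈ X → IsWalk X (append p k y) (suc k)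
  walk-append {X} {p} {k} {y} w e y∈X = record { inside = inside′ ; steps = steps′ }
    where
      inside′ : ∀ i → i ≤ suc k → append p k y i ∈ X
      inside′ i i≤1+k with m≤n⇒m<n∨m≡n i≤1+k
      ... | inj₁ i<1+k = subst (_∈ X) (≡-sym (append-old p k y i (≤-pred i<1+k))) (inside w i (≤-pred i<1+k))
      ... | inj₂ refl = subst (_∈ X) (≡-sym (append-new p k y)) y∈X
      steps′ : ∀ i → i < suc k → E (append p k y i) (append p k y (suc i))
      steps′ i (s≤s i≤k) with m≤n⇒m<n∨m≡n i≤k
      ... | inj₁ i<k rewrite append-old p k y i i≤k | append-old p k y (suc i) i<k = steps w i i<k
      ... | inj₂ refl rewrite append-old p k y i i≤k | append-new p k y = e

  skip : (ℕ → Fin n) → ℕ → ℕ → ℕ → Fin n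
  skip p a δ i with i ≤? a
  ... | yes _ = p i
  ... | no _ = p (i + δ)

  skip-before : ∀ p a δ i → i ≤ a → skip p a δ i ≡ p i
  skip-before p a δ i i≤a with i ≤? a
  ... | yes _ = refl
  ... | no i≰a = contradiction i≤a i≰a

  skip-after : ∀ p a δ i → a < i → skip p a δ i ≡ p (i + δ)
  skip-after p a δ i a<i with i ≤? a
  ... | yes i≤a = contradiction i≤a (<⇒≱ a<i)
  ... | no _ = refl

  walk-skip : ∀ {X p} a δ k → a < k → E (p a) (p (suc a + δ)) → IsWalk X p (k + δ) →
              IsWalk X (skip p a δ) k
  walk-skip {X} {p} a δ k a<k chord w = record { inside = inside′ ; steps = steps′ }
    where
      inside′ : ∀ i → i ≤ k → skip p a δ i ∈ X
      inside′ i i≤k with i ≤? a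
      ... | yes _ = inside w i (≤-trans i≤k (m≤m+n k δ))
      ... | no _ = inside w (i + δ) (+-monoˡ-≤ δ i≤k)
      steps′ : ∀ i → i < k → E (skip p a δ i) (skip p a δ (suc i))
      steps′ i i<k with <-cmp i a
      ... | tri< i<a _ _ rewrite skip-before p a δ i (<⇒≤ i<a) | skip-before p a δ (suc i) i<a =
            steps w i (<-≤-trans i<k (m≤m+n k δ))
      ... | tri≈ _ refl _ rewrite skip-before p a δ i ≤-refl | skip-after p a δ (suc i) ≤-refl = chord
      ... | tri> _ _ a<i rewrite skip-after p a δ i a<i | skip-after p a δ (suc i) (m<n⇒m<1+n a<i) =
            steps w (i + δ) (+-monoˡ-< δ i<k)

  walk-here : ∀ {X x} → x ∈ X → Walk X x x
  walk-here {x = x} x∈X = record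
    { len = 0 ; vertex = λ _ → x ; start = refl ; end = refl
    ; isWalk = record { inside = λ _ _ → x∈X ; steps = λ _ () } }

  walk-step : ∀ {X x y z} → Walk X x y → E y z → z ∈ X → Walk X x z
  walk-step {z = z} w e z∈X = record
    { len = suc (len w) ; vertex = append (vertex w) (len w) z
    ; isWalk = walk-append (isWalk w) (subst (λ v → E v z) (≡-sym (end w)) e) z∈X
    ; start = trans (append-old (vertex w) (len w) z 0 z≤n) (start w)
    ; end = append-new (vertex w) (len w) z }

  walk-widen : ∀ {X Y x y} → X ⊆ Y → Walk X x y → Walk Y x y
  walk-widen X⊆Y w = record
    { len = len w ; vertex = vertex w ; isWalk = walk-mono X⊆Y (isWalk w) ; start = start w ; end = end w }

-- The component of u is the saturation of
-- {u} under adding vertices outside Ω adjacent to the current set; it is the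
-- least "Ω-closed" set containing u, and it is connected by walks.
module Components {n : ℕ} (H : Graph n) (Ω : Subset n) where
  open Adjacency H
  open Walks H

  Closed : Subset n → Set
  Closed X = ∀ {z y} → z ∈ X → E z y → y ∉ Ω → y ∈ X

  OnFrontier : Subset n → Fin n → Set
  OnFrontier X y = y ∉ Ω × ∃ λ z → z ∈ X × E z y

  frontier? : ∀ X y → Dec (OnFrontier X y)
  frontier? X y = ¬? (y ∈? Ω) ×-dec any? (λ z → (z ∈? X) ×-dec E? z y)

  frontier : Subset n → Subset n
  frontier X = fromDec (frontier? X)

  grow : Subset n → Subset n
  grow X = X ∪ frontier X

  grow-inflates : ∀ {X} → X ⊆ grow X
  grow-inflates {X} = p⊆p∪q (frontier X)

  grow⁻ : ∀ {X y} → y ∈ grow X → y ∈ X ⊎ OnFrontier X y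
  grow⁻ {X} y∈ with x∈p∪q⁻ X (frontier X) y∈
  ... | inj₁ y∈X = inj₁ y∈X
  ... | inj₂ y∈F = inj₂ (∈fromDec⁻ (frontier? X) y∈F)

  -- The component of u: n steps of growth from {u} reach saturation.
  comp : Fin n → Subset n
  comp u = iter grow ⁅ u ⁆ n

  comp-self : ∀ u → u ∈ comp u
  comp-self u = Saturation.iter-inflates grow grow-inflates ⁅ u ⁆ n (x∈⁅x⁆ u)

  comp-closed : ∀ u → Closed (comp u)
  comp-closed u z∈ e y∉Ω =
    Saturation.saturated grow grow-inflates ⁅ u ⁆
      (q⊆p∪q (comp u) _ (∈fromDec⁺ (frontier? (comp u)) (y∉Ω , _ , z∈ , e)))

  comp-least : ∀ u {X} → u ∈ X → Closed X → comp u ⊆ X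
  comp-least u {X} u∈X closed = go n
    where
      go : ∀ i → iter grow ⁅ u ⁆ i ⊆ X
      go zero y∈ rewrite x∈⁅y⁆⇒x≡y u y∈ = u∈X
      go (suc i) y∈ with grow⁻ y∈
      ... | inj₁ y∈R = go i y∈R
      ... | inj₂ (y∉Ω , z , z∈R , e) = closed (go i z∈R) e y∉Ω

  comp-avoids : ∀ {u y} → u ∉ Ω → y ∈ comp u → y ∉ Ω
  comp-avoids {u} u∉Ω y∈ = x∈∁p⇒x∉p (comp-least u (x∉p⇒x∈∁p u∉Ω) (λ _ _ y∉Ω → x∉p⇒x∈∁p y∉Ω) y∈)

  comp-sym : ∀ {u y} → u ∉ Ω → y ∈ comp u → u ∈ comp y
  comp-sym {u} u∉Ω y∈ = proj₂ (∈fromDec⁻ Back? (comp-least u (∈fromDec⁺ Back? (u∉Ω , comp-self u)) closed y∈))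
    where
      Back? : ∀ z → Dec (z ∉ Ω × u ∈ comp z)
      Back? z = ¬? (z ∈? Ω) ×-dec (u ∈? comp z)
      closed : Closed (fromDec Back?)
      closed {z} {y} z∈ e y∉Ω =
        let z∉Ω , u∈z = ∈fromDec⁻ Back? z∈
            z∈y = comp-closed y (comp-self y) (E-sym e) z∉Ω
        in ∈fromDec⁺ Back? (y∉Ω , comp-least z z∈y (comp-closed y) u∈z)

  comp-reach : ∀ u {y} → y ∈ comp u → Walk (comp u) u y
  comp-reach u = go n
    where
      go : ∀ i {y} → y ∈ iter grow ⁅ u ⁆ i → Walk (iter grow ⁅ u ⁆ i) u y
      go zero y∈ rewrite x∈⁅y⁆⇒x≡y u y∈ = walk-here (x∈⁅x⁆ u)
      go (suc i) y∈ with grow⁻ y∈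
      ... | inj₁ y∈R = walk-widen grow-inflates (go i y∈R)
      ... | inj₂ (y∉Ω , z , z∈R , e) = walk-step (walk-widen grow-inflates (go i z∈R)) e y∈

  comp-connected : ∀ {u v w} → u ∉ Ω → v ∈ comp u → w ∈ comp u → Walk (comp u) v w
  comp-connected {u} {v} u∉Ω v∈ w∈ =
    walk-widen (comp-least v v∈ (comp-closed u))
               (comp-reach v (comp-least u (comp-sym u∉Ω v∈) (comp-closed v) w∈))

-- Every clique of H extends to a maximal clique: scan all vertices once,
-- adding each vertex adjacent to everything chosen so far.
module MaximalCliques {n : ℕ} (H : Graph n) where
  open Adjacency H

  Extends : Subset n → Fin n → Set
  Extends K x = ∀ y → y ∈ K → y ≢ x → E x y

  extends? : ∀ K x → Dec (Extends K x)
  extends? K x = all? (λ y → (y ∈? K) →-dec (¬? (y ≟ᶠ x) →-dec E? x y))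

  greedy : Subset n → List (Fin n) → Subset n
  greedy-step : ∀ K x → List (Fin n) → Dec (Extends K x) → Subset n
  greedy K [] = K
  greedy K (x ∷ xs) = greedy-step K x xs (extends? K x)
  greedy-step K x xs (yes _) = greedy (K ∪ ⁅ x ⁆) xs
  greedy-step K x xs (no _) = greedy K xs

  add-clique : ∀ {K x} → IsClique H K → Extends K x → IsClique H (K ∪ ⁅ x ⁆)
  add-clique {K} {x} cl ext a b a∈ b∈ a≢b with x∈p∪q⁻ K _ a∈ | x∈p∪q⁻ K _ b∈
  ... | inj₁ a∈K | inj₁ b∈K = cl a b a∈K b∈K a≢b
  ... | inj₁ a∈K | inj₂ b∈x rewrite x∈⁅y⁆⇒x≡y x b∈x = E-sym (ext a a∈K a≢b)
  ... | inj₂ a∈x | inj₁ b∈K rewrite x∈⁅y⁆⇒x≡y x a∈x = ext b b∈K (λ b≡x → a≢b (≡-sym b≡x))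
  ... | inj₂ a∈x | inj₂ b∈x rewrite x∈⁅y⁆⇒x≡y x a∈x | x∈⁅y⁆⇒x≡y x b∈x = contradiction refl a≢b

  greedy-clique : ∀ K xs → IsClique H K → IsClique H (greedy K xs)
  greedy-clique K [] cl = cl
  greedy-clique K (x ∷ xs) cl with extends? K x
  ... | yes ext = greedy-clique (K ∪ ⁅ x ⁆) xs (add-clique cl ext)
  ... | no _ = greedy-clique K xs cl

  greedy-grows : ∀ K xs → K ⊆ greedy K xs
  greedy-grows K [] y∈ = y∈
  greedy-grows K (x ∷ xs) y∈ with extends? K x
  ... | yes _ = greedy-grows (K ∪ ⁅ x ⁆) xs (p⊆p∪q _ y∈)
  ... | no _ = greedy-grows K xs y∈

  greedy-saturates : ∀ K xs {K′} → IsClique H K′ → greedy K xs ⊆ K′ →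
                     ∀ {x} → x ∈ˡ xs → x ∈ K′ → x ∈ greedy K xs
  greedy-saturates K (y ∷ xs) cl sub x∈xs x∈K′ with extends? K y | x∈xs
  ... | yes _ | there x∈ = greedy-saturates (K ∪ ⁅ y ⁆) xs cl sub x∈ x∈K′
  ... | no _ | there x∈ = greedy-saturates K xs cl sub x∈ x∈K′
  ... | yes _ | here refl = greedy-grows (K ∪ ⁅ y ⁆) xs (q⊆p∪q K _ (x∈⁅x⁆ y))
  ... | no cannot | here refl = contradiction adjacent cannot
    where
      adjacent : Extends K y
      adjacent z z∈K z≢y = E-sym (cl z y (sub (greedy-grows K xs z∈K)) x∈K′ z≢y)

  extend-to-maximal : ∀ K → IsClique H K → ∃ λ Ω → K ⊆ Ω × IsMaximalClique H Ω
  extend-to-maximal K cl =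
    greedy K (allFin n) , greedy-grows K (allFin n) , greedy-clique K (allFin n) cl ,
    λ K′ clK′ sub x∈K′ → greedy-saturates K (allFin n) clK′ sub (∈-allFin _) x∈K′

  InStar : Subset n → Fin n → Fin n → Set
  InStar K v y = y ≡ v ⊎ (y ∈ K × E v y)

  inStar? : ∀ K v y → Dec (InStar K v y)
  inStar? K v y = (y ≟ᶠ v) ⊎-dec ((y ∈? K) ×-dec E? v y)

  star : Subset n → Fin n → Subset n
  star K v = fromDec (inStar? K v)

  centre∈star : ∀ K v → v ∈ star K v
  centre∈star K v = ∈fromDec⁺ (inStar? K v) (inj₁ refl)

  leaf∈star : ∀ {K v y} → y ∈ K → E v y → y ∈ star K v
  leaf∈star {K} {v} y∈K vy = ∈fromDec⁺ (inStar? K v) (inj₂ (y∈K , vy))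

  star-clique : ∀ {K} v → IsClique H K → IsClique H (star K v)
  star-clique {K} v cl a b a∈ b∈ a≢b with ∈fromDec⁻ (inStar? K v) a∈ | ∈fromDec⁻ (inStar? K v) b∈
  ... | inj₁ refl | inj₁ refl = contradiction refl a≢b
  ... | inj₁ refl | inj₂ (_ , vb) = vb
  ... | inj₂ (_ , va) | inj₁ refl = E-sym va
  ... | inj₂ (a∈K , _) | inj₂ (b∈K , _) = cl a b a∈K b∈K a≢b

-- Let Ω be a clique of a
-- chordal graph H and D a set of vertices disjoint from Ω.  A walk in D whose
-- last vertex sees s ∈ Ω can be shortened to a "tight" one (induced, seeing s
-- only at its end), and the end of a tight walk sees every vertex of Ω seen by
-- its start: otherwise a chordless cycle of length ≥ 4 appears.
module TightApproaches {n : ℕ} (H : Graph n) (chordal : Chordal H)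
                       (Ω : Subset n) (Ω-clique : IsClique H Ω)
                       (D : Subset n) (D-avoids : ∀ {x} → x ∈ D → x ∉ Ω) where
  open Adjacency H
  open Walks H

  record Approach (s : Fin n) (p : ℕ → Fin n) (k : ℕ) : Set where
    field
      walk    : IsWalk D p k
      reaches : E (p k) s
  open Approach

  record Tight (s : Fin n) (p : ℕ → Fin n) (k : ℕ) : Set where
    field
      approach  : Approach s p k
      sees-late : ∀ j → j < k → ¬ E (p j) s
      chordless : ∀ a b → 2 + a ≤ b → b ≤ k → ¬ E (p a) (p b)
  open Tight

  -- A tight approach visits distinct vertices: a repetition would create a
  -- loop, a chord, or an early sight of s.
  tight-injective : ∀ {s p k} → Tight s p k → ∀ a b → a < b → b ≤ k → p a ≢ p b
  tight-injective {s} {p} T a b a<b b≤k pa≡pb with m≤n⇒m<n∨m≡n a<b | m≤n⇒m<n∨m≡n b≤k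
  ... | inj₂ refl | _ =
        E-irrefl (subst (E (p a)) (≡-sym pa≡pb) (steps (walk (approach T)) a b≤k))
  ... | inj₁ 2+a≤b | inj₁ b<k =
        chordless T a (suc b) (m≤n⇒m≤1+n 2+a≤b) b<k
          (subst (λ v → E v (p (suc b))) (≡-sym pa≡pb) (steps (walk (approach T)) b b<k))
  ... | inj₁ _ | inj₂ refl =
        sees-late T a a<b (subst (λ v → E v s) (≡-sym pa≡pb) (reaches (approach T)))

  tight-suffix : ∀ {s p} i {L} → Tight s p (i + L) → Tight s (λ j → p (i + j)) L
  tight-suffix i T = record
    { approach  = record { walk = walk-suffix i (walk (approach T)) ; reaches = reaches (approach T) }
    ; sees-late = λ j j<L → sees-late T (i + j) (+-monoʳ-< i j<L)
    ; chordless = λ a b 2+a≤b b≤L → chordless T (i + a) (i + b) (shift 2+a≤b) (+-monoʳ-≤ i b≤L) }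
    where
      shift : ∀ {a b} → 2 + a ≤ b → 2 + (i + a) ≤ i + b
      shift {a} {b} 2+a≤b =
        subst (_≤ i + b) (trans (+-suc i (suc a)) (cong suc (+-suc i a))) (+-monoʳ-≤ i 2+a≤b)

  -- A tight approach p 0, …, p L (L ≥ 1) to s ∈ Ω in which only p 0 sees
  -- t ∈ Ω would close, with the edge s t, the chordless cycle
  -- t, p 0, …, p L, s of length L + 3 ≥ 4.
  module FanCycle {s t : Fin n} {p : ℕ → Fin n} {L : ℕ}
                  (s∈Ω : s ∈ Ω) (t∈Ω : t ∈ Ω) (L≥1 : 1 ≤ L) (T : Tight s p L)
                  (first : E (p 0) t) (only-first : ∀ j → 0 < j → j ≤ L → ¬ E (p j) t) where

    -- The cycle is cyc 0 = t, cyc (1 + j) = p j for j ≤ L, cyc (L + 2) = s.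
    body : ℕ → Fin n
    body j with j ≤? L
    ... | yes _ = p j
    ... | no _ = s

    body-path : ∀ j → j ≤ L → body j ≡ p j
    body-path j j≤L with j ≤? L
    ... | yes _ = refl
    ... | no j≰L = contradiction j≤L j≰L

    body-end : ∀ j → L < j → body j ≡ s
    body-end j L<j with j ≤? L
    ... | yes j≤L = contradiction j≤L (<⇒≱ L<j)
    ... | no _ = refl

    cyc : ℕ → Fin n
    cyc zero = t
    cyc (suc j) = body j

    t≢s : t ≢ s
    t≢s refl = sees-late T 0 L≥1 first

    path-avoids : ∀ j → j ≤ L → p j ∉ Ω
    path-avoids j j≤L = D-avoids (inside (walk (approach T)) j j≤L)

    cyc-distinct : ∀ x y → x < y → y < 3 + L → cyc x ≢ cyc y
    cyc-distinct zero (suc y) _ (s≤s (s≤s y≤1+L)) eq with ≤-<-connex y L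
    ... | inj₁ y≤L rewrite body-path y y≤L = path-avoids y y≤L (subst (_∈ Ω) eq t∈Ω)
    ... | inj₂ L<y rewrite body-end y L<y = t≢s eq
    cyc-distinct (suc x) (suc y) (s≤s x<y) (s≤s (s≤s y≤1+L)) eq with ≤-<-connex y L
    ... | inj₁ y≤L rewrite body-path y y≤L | body-path x (≤-trans (<⇒≤ x<y) y≤L) =
          tight-injective T x y x<y y≤L eq
    ... | inj₂ L<y rewrite body-end y L<y with ≤-<-connex x L
    ...   | inj₁ x≤L rewrite body-path x x≤L = path-avoids x x≤L (subst (_∈ Ω) (≡-sym eq) s∈Ω)
    ...   | inj₂ L<x = <⇒≱ (≤-trans (s≤s L<x) x<y) y≤1+L

    cyc-injective : ∀ x y → x < 3 + L → y < 3 + L → cyc x ≡ cyc y → x ≡ y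
    cyc-injective x y x< y< eq with <-cmp x y
    ... | tri< x<y _ _ = contradiction eq (cyc-distinct x y x<y y<)
    ... | tri≈ _ x≡y _ = x≡y
    ... | tri> _ _ y<x = contradiction (≡-sym eq) (cyc-distinct y x y<x x<)

    cyc-steps : ∀ j → suc j < 3 + L → E (cyc j) (cyc (suc j))
    cyc-steps zero _ = subst (E t) (≡-sym (body-path 0 z≤n)) (E-sym first)
    cyc-steps (suc j) (s≤s (s≤s (s≤s j≤L))) with m≤n⇒m<n∨m≡n j≤L
    ... | inj₁ j<L rewrite body-path j j≤L | body-path (suc j) j<L = steps (walk (approach T)) j j<L
    ... | inj₂ refl rewrite body-path j j≤L | body-end (suc j) ≤-refl = reaches (approach T)

    cyc-closes : E (cyc (2 + L)) (cyc 0)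
    cyc-closes rewrite body-end (suc L) ≤-refl = Ω-clique s t s∈Ω t∈Ω (λ s≡t → t≢s (≡-sym s≡t))

    -- A chord would be t — p j (j ≥ 1), p a — p b (b ≥ a + 2) or p a — s (a < L).
    cyc-chordless : ¬ HasChord H (3 + L) cyc
    cyc-chordless (zero , suc y , s≤s 1≤y , s≤s (s≤s y≤1+L) , not-closing , chord) with ≤-<-connex y L
    ... | inj₁ y≤L rewrite body-path y y≤L = only-first y 1≤y y≤L (E-sym chord)
    ... | inj₂ L<y = not-closing (refl , cong (λ z → 2 + z) (≤-antisym y≤1+L L<y))
    cyc-chordless (suc x , suc y , s≤s 2+x≤y , s≤s (s≤s y≤1+L) , _ , chord) with ≤-<-connex y L
    ... | inj₁ y≤L rewrite body-path y y≤L | body-path x (≤-trans (m≤n+m x 2) (≤-trans 2+x≤y y≤L)) =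
          chordless T x y 2+x≤y y≤L chord
    ... | inj₂ L<y rewrite body-end y L<y =
          sees-late T x x<L (subst (λ v → E v s) (body-path x (<⇒≤ x<L)) chord)
      where
        x<L : x < L
        x<L = ≤-pred (≤-trans 2+x≤y y≤1+L)

    absurd : Empty
    absurd = cyc-chordless (chordal (3 + L) cyc (s≤s (s≤s (s≤s L≥1)))
                                   (cyc-injective , cyc-steps , cyc-closes))

  -- The end of a tight approach to s ∈ Ω sees every t ∈ Ω seen by its start:
  -- after the last vertex seeing t, the approach would form a fan cycle.
  tight-end-sees : ∀ {s t p k} → s ∈ Ω → t ∈ Ω → Tight s p k → E (p 0) t → E (p k) t
  tight-end-sees {s} {t} {p} {k} s∈Ω t∈Ω T first with lastWitness (λ j → E? (p j) t) first k
  ... | i , i≤k , sees , later with m≤n⇒m<n∨m≡n i≤k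
  ...   | inj₂ refl = sees
  ...   | inj₁ i<k = ⊥-elim (FanCycle.absurd s∈Ω t∈Ω (m+n≤o⇒m≤o∸n 1 i<k) (tight-suffix i T′) sees′ later′)
    where
      i+[k∸i]≡k : i + (k ∸ i) ≡ k
      i+[k∸i]≡k = m+[n∸m]≡n i≤k
      T′ : Tight s p (i + (k ∸ i))
      T′ = subst (Tight s p) (≡-sym i+[k∸i]≡k) T
      sees′ : E (p (i + 0)) t
      sees′ = subst (λ m → E (p m) t) (≡-sym (+-identityʳ i)) sees
      later′ : ∀ j → 0 < j → j ≤ k ∸ i → ¬ E (p (i + j)) t
      later′ j 0<j j≤k∸i = later (i + j) (m<m+n i 0<j) (subst (i + j ≤_) i+[k∸i]≡k (+-monoʳ-≤ i j≤k∸i))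

  approach-prefix : ∀ {s p k j} → j ≤ k → E (p j) s → Approach s p k → Approach s p j
  approach-prefix j≤k e A = record { walk = walk-prefix j≤k (walk A) ; reaches = e }

  shortcut : ∀ {s p k} a b → 2 + a ≤ b → b ≤ k → E (p a) (p b) → Approach s p k →
             ∃ λ k′ → k′ < k × Approach s (skip p a (b ∸ suc a)) k′
  shortcut {s} {p} {k} a b 2+a≤b b≤k chord A =
    k ∸ δ , ∸-monoʳ-< {o = 0} δ≥1 δ≤k ,
    record { walk = walk-skip a δ (k ∸ δ) a<k∸δ chord′ walk′ ; reaches = reaches′ }
    where
      δ = b ∸ suc a
      1+a+δ≡b : suc a + δ ≡ b
      1+a+δ≡b = m+[n∸m]≡n (<⇒≤ 2+a≤b)
      1+a+δ≤k : suc a + δ ≤ k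
      1+a+δ≤k = subst (_≤ k) (≡-sym 1+a+δ≡b) b≤k
      δ≥1 : 1 ≤ δ
      δ≥1 = m+n≤o⇒m≤o∸n 1 2+a≤b
      δ≤k : δ ≤ k
      δ≤k = m+n≤o⇒n≤o (suc a) 1+a+δ≤k
      a<k∸δ : a < k ∸ δ
      a<k∸δ = m+n≤o⇒m≤o∸n (suc a) 1+a+δ≤k
      k∸δ+δ≡k : k ∸ δ + δ ≡ k
      k∸δ+δ≡k = m∸n+n≡m δ≤k
      chord′ : E (p a) (p (suc a + δ))
      chord′ = subst (λ m → E (p a) (p m)) (≡-sym 1+a+δ≡b) chord
      walk′ : IsWalk D p (k ∸ δ + δ)
      walk′ = subst (IsWalk D p) (≡-sym k∸δ+δ≡k) (walk A)
      reaches′ : E (skip p a δ (k ∸ δ)) s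
      reaches′ = subst (λ v → E v s)
                       (≡-sym (trans (skip-after p a δ (k ∸ δ) a<k∸δ) (cong p k∸δ+δ≡k)))
                       (reaches A)

  TightFrom : Fin n → Fin n → Set
  TightFrom s v = ∃₂ λ q k → q 0 ≡ v × Tight s q k

  -- Every approach shortens to a tight one with the same start: cut it at the
  -- first vertex seeing s, or bypass a chord, until neither is possible.
  tighten : ∀ {s} k p → Approach s p k → TightFrom s (p 0)
  tighten {s} = <-rec (λ k → ∀ p → Approach s p k → TightFrom s (p 0)) shorten
    where
      shorten : ∀ k → (∀ {j} → j < k → ∀ p → Approach s p j → TightFrom s (p 0)) →
                ∀ p → Approach s p k → TightFrom s (p 0)
      shorten k rec p A with anyUpTo? (λ j → E? (p j) s) k
      ... | yes (j , j<k , e) = rec j<k p (approach-prefix (<⇒≤ j<k) e A)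
      ... | no early with anyUpTo? (λ b → anyUpTo? (λ a → (2 + a ≤? b) ×-dec E? (p a) (p b)) b) (suc k)
      ...   | yes (b , s≤s b≤k , a , _ , 2+a≤b , chord) with shortcut a b 2+a≤b b≤k chord A
      ...     | k′ , k′<k , A′ with rec k′<k _ A′
      ...       | q , k″ , q0 , T = q , k″ , trans q0 (skip-before p a (b ∸ suc a) 0 z≤n) , T
      shorten k rec p A | no early | no chord-free = p , k , refl , record
        { approach  = A
        ; sees-late = λ j j<k e → early (j , j<k , e)
        ; chordless = λ a b 2+a≤b b≤k chord → chord-free (b , s≤s b≤k , a , <⇒≤ 2+a≤b , 2+a≤b , chord) }

  Attached : Fin n → Set
  Attached y = y ∈ Ω × ∃ λ x → x ∈ D × E x y

  attached? : ∀ y → Dec (Attached y)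
  attached? y = (y ∈? Ω) ×-dec any? (λ x → (x ∈? D) ×-dec E? x y)

  module Domination (connected : ∀ {v w} → v ∈ D → w ∈ D → Walk D v w) where

    -- From v ∈ D, a tight approach to an attached s ends at a vertex of D
    -- seeing s and every vertex of Ω that v sees.
    dominate-step : ∀ {v s} → v ∈ D → Attached s →
                    ∃ λ u → u ∈ D × E u s × (∀ t → t ∈ Ω → E v t → E u t)
    dominate-step {v} {s} v∈D (s∈Ω , x , x∈D , e) = conclude (tighten (len w) (vertex w) A)
      where
        w : Walk D v x
        w = connected v∈D x∈D
        A : Approach s (vertex w) (len w)
        A = record { walk = isWalk w ; reaches = subst (λ y → E y s) (≡-sym (end w)) e }
        conclude : TightFrom s (vertex w 0) → ∃ λ u → u ∈ D × E u s × (∀ t → t ∈ Ω → E v t → E u t)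
        conclude (q , k , q0 , T) =
          q k , inside (walk (approach T)) k ≤-refl , reaches (approach T) ,
          λ t t∈Ω vt → tight-end-sees s∈Ω t∈Ω T (subst (λ y → E y t) (≡-sym (trans q0 (start w))) vt)

    dominate-list : ∀ {v₀} → v₀ ∈ D → ∀ ys → ∃ λ v → v ∈ D × (∀ y → y ∈ˡ ys → Attached y → E v y)
    dominate-list v₀∈D [] = _ , v₀∈D , λ _ ()
    dominate-list v₀∈D (y ∷ ys) with dominate-list v₀∈D ys | attached? y
    ... | v , v∈D , sees | no detached =
          v , v∈D , λ { _ (here refl) att → contradiction att detached ; y′ (there y′∈) → sees y′ y′∈ }
    ... | v , v∈D , sees | yes att with dominate-step v∈D att
    ...   | u , u∈D , sees-y , keeps =
            u , u∈D , λ { _ (here refl) _ → sees-y ; y′ (there y′∈) att′ → keeps y′ (proj₁ att′) (sees y′ y′∈ att′) }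

    dominate : ∀ {v₀} → v₀ ∈ D → ∃ λ v → v ∈ D × (∀ y → Attached y → E v y)
    dominate v₀∈D with dominate-list v₀∈D (allFin n)
    ... | v , v∈D , sees = v , v∈D , λ y → sees y (∈-allFin y)

weight : ∀ {n} → List (Subset n) → Subset n → ℕ
weight 𝒲 X = length (restrict 𝒲 X)

meets-mono : ∀ {n} (W : Subset n) {X Y} → X ⊆ Y → Nonempty (W ∩ X) → Nonempty (W ∩ Y)
meets-mono W {X} X⊆Y (x , x∈W∩X) =
  let x∈W , x∈X = x∈p∩q⁻ W X x∈W∩X in x , x∈p∩q⁺ (x∈W , X⊆Y x∈X)

weight-mono : ∀ {n} (𝒲 : List (Subset n)) {X Y} → X ⊆ Y → weight 𝒲 X ≤ weight 𝒲 Y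
weight-mono [] X⊆Y = z≤n
weight-mono (W ∷ 𝒲) {X} {Y} X⊆Y with nonempty? (W ∩ X) | nonempty? (W ∩ Y)
... | yes _ | yes _ = s≤s (weight-mono 𝒲 X⊆Y)
... | yes meetsX | no missesY = contradiction (meets-mono W X⊆Y meetsX) missesY
... | no _ | yes _ = m≤n⇒m≤1+n (weight-mono 𝒲 X⊆Y)
... | no _ | no _ = weight-mono 𝒲 X⊆Y

weight-disjoint : ∀ {n} (𝒲 : List (Subset n)) {X Y} →
                  (∀ {W} → W ∈ˡ 𝒲 → Nonempty (W ∩ X) → ¬ Nonempty (W ∩ Y)) →
                  weight 𝒲 X + weight 𝒲 Y ≤ length 𝒲
weight-disjoint [] _ = z≤n
weight-disjoint (W ∷ 𝒲) {X} {Y} apart with nonempty? (W ∩ X) | nonempty? (W ∩ Y)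
... | yes meetsX | yes meetsY = contradiction meetsY (apart (here refl) meetsX)
... | yes _ | no _ = s≤s (weight-disjoint 𝒲 (apart ∘ there))
... | no _ | yes _ rewrite +-suc (weight 𝒲 X) (weight 𝒲 Y) = s≤s (weight-disjoint 𝒲 (apart ∘ there))
... | no _ | no _ = m≤n⇒m≤1+n (weight-disjoint 𝒲 (apart ∘ there))

not-both-heavy : ∀ m a b → a + b ≤ m → m < 2 * a → ¬ (m < 2 * b)
not-both-heavy m a b a+b≤m m<2a m<2b = <⇒≱ (+-mono-< m<2a m<2b) 2a+2b≤m+m
  where
    2a+2b≤m+m : 2 * a + 2 * b ≤ m + m
    2a+2b≤m+m rewrite ≡-sym (*-distribˡ-+ 2 a b) | +-identityʳ (a + b) = +-mono-≤ a+b≤m a+b≤m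

module Balancing {n : ℕ} (G H : Graph n) (𝒲 : List (Subset n)) (cover : IsEdgeCliqueCover G 𝒲)
                 (chordal : Chordal H) (G⊆H : G ⊆ᴱ H) where
  open Adjacency H
  open Components H using (comp; comp-self; comp-closed; comp-least; comp-avoids; comp-connected)
  open MaximalCliques H using (extend-to-maximal; star; star-clique; centre∈star; leaf∈star)

  Heavy : Subset n → Set
  Heavy X = length 𝒲 < 2 * weight 𝒲 X

  heavy? : ∀ X → Dec (Heavy X)
  heavy? X = length 𝒲 <? 2 * weight 𝒲 X

  -- No member of 𝒲, being a clique of G ⊆ H, meets two disjoint sets
  -- without H-edges between them; so those two are not both heavy.
  separated-not-both-heavy : ∀ {A B} → (∀ {a b} → a ∈ A → b ∈ B → a ≢ b × ¬ E a b) →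
                             Heavy A → ¬ Heavy B
  separated-not-both-heavy {A} {B} separated =
    not-both-heavy (length 𝒲) (weight 𝒲 A) (weight 𝒲 B) (weight-disjoint 𝒲 apart)
    where
      apart : ∀ {W} → W ∈ˡ 𝒲 → Nonempty (W ∩ A) → ¬ Nonempty (W ∩ B)
      apart W∈𝒲 (a , a∈W∩A) (b , b∈W∩B) =
        let a∈W , a∈A = x∈p∩q⁻ _ A a∈W∩A
            b∈W , b∈B = x∈p∩q⁻ _ B b∈W∩B
            a≢b , ¬ab = separated a∈A b∈B
        in ¬ab (G⊆H a b (lookupAll (proj₁ (proj₂ cover)) W∈𝒲 a b a∈W b∈W a≢b))

  Balanced : Subset n → Set
  Balanced Ω = ∀ u → u ∉ Ω → ¬ Heavy (comp Ω u)

  -- A component of G ∖ Ω lies in a component of H ∖ Ω, so for balanced Ω it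
  -- meets at most half of 𝒲.
  balanced-G-components : ∀ {Ω} → Balanced Ω → ∀ C → IsComponentMinus G Ω C → 2 * weight 𝒲 C ≤ length 𝒲
  balanced-G-components {Ω} balanced C ((x , x∈C) , avoids , connected , _) =
    ≤-trans (*-monoʳ-≤ 2 (weight-mono 𝒲 C⊆comp)) (≮⇒≥ (balanced x (avoids x x∈C)))
    where
      into-comp : ∀ {y} → Reach G C x y → y ∈ comp Ω x
      into-comp (here _) = comp-self Ω x
      into-comp (step r e z∈C) = comp-closed Ω x (into-comp r) (G⊆H _ _ e) (avoids _ z∈C)
      C⊆comp : C ⊆ comp Ω x
      C⊆comp {y} y∈C = into-comp (connected x y x∈C y∈C)

  -- Moving Ω towards a component D of H ∖ Ω: let v ∈ D see every vertex of
  -- Ω attached to D, and let Ω′ contain v and its neighbours in Ω.  Then D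
  -- stays closed in H ∖ Ω′, and if D is heavy, every heavy component of
  -- H ∖ Ω′ is a proper subset of D (it misses v).
  module Shift (Ω : Subset n) (u : Fin n) (v : Fin n) (v∈D : v ∈ comp Ω u)
               (v-sees : ∀ {x y} → x ∈ comp Ω u → E x y → y ∈ Ω → E v y)
               (Ω′ : Subset n) (v∈Ω′ : v ∈ Ω′) (nbrs⊆Ω′ : ∀ {y} → y ∈ Ω → E v y → y ∈ Ω′) where

    D : Subset n
    D = comp Ω u

    D-closed′ : ∀ {x y} → x ∈ D → E x y → y ∉ Ω′ → y ∈ D
    D-closed′ {x} {y} x∈D e y∉Ω′ with y ∈? Ω
    ... | yes y∈Ω = contradiction (nbrs⊆Ω′ y∈Ω (v-sees x∈D e y∈Ω)) y∉Ω′
    ... | no y∉Ω = comp-closed Ω u x∈D e y∉Ω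

    shrinks : Heavy D → ∀ u′ → u′ ∉ Ω′ → Heavy (comp Ω′ u′) → ∣ comp Ω′ u′ ∣ < ∣ D ∣
    shrinks heavyD u′ u′∉Ω′ heavy′ with u′ ∈? D
    ... | yes u′∈D = p⊂q⇒∣p∣<∣q∣ (comp-least Ω′ u′ u′∈D D-closed′ , v , v∈D , v∉comp)
      where
        v∉comp : v ∉ comp Ω′ u′
        v∉comp v∈comp = comp-avoids Ω′ u′∉Ω′ v∈comp v∈Ω′
    ... | no u′∉D = contradiction heavy′ (separated-not-both-heavy separated heavyD)
      where
        Outside? : ∀ y → Dec (y ∉ D × y ∉ Ω′)
        Outside? y = ¬? (y ∈? D) ×-dec ¬? (y ∈? Ω′)
        outside-closed : ∀ {z y} → z ∈ fromDec Outside? → E z y → y ∉ Ω′ → y ∈ fromDec Outside?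
        outside-closed z∈ e y∉Ω′ =
          let z∉D , z∉Ω′ = ∈fromDec⁻ Outside? z∈
          in ∈fromDec⁺ Outside? ((λ y∈D → z∉D (D-closed′ y∈D (E-sym e) z∉Ω′)) , y∉Ω′)
        comp⊆outside : comp Ω′ u′ ⊆ fromDec Outside?
        comp⊆outside = comp-least Ω′ u′ (∈fromDec⁺ Outside? (u′∉D , u′∉Ω′)) outside-closed
        separated : ∀ {a b} → a ∈ D → b ∈ comp Ω′ u′ → a ≢ b × ¬ E a b
        separated a∈D b∈comp =
          let b∉D , b∉Ω′ = ∈fromDec⁻ Outside? (comp⊆outside b∈comp)
          in (λ { refl → b∉D a∈D }) , (λ e → b∉D (D-closed′ a∈D e b∉Ω′))

  dominating-vertex : ∀ {Ω u} → IsClique H Ω → u ∉ Ω →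
                      ∃ λ v → v ∈ comp Ω u × (∀ {x y} → x ∈ comp Ω u → E x y → y ∈ Ω → E v y)
  dominating-vertex {Ω} {u} Ω-clique u∉Ω =
    let v , v∈D , sees = dominate (comp-self Ω u)
    in v , v∈D , λ x∈D e y∈Ω → sees _ (y∈Ω , _ , x∈D , e)
    where
      open TightApproaches H chordal Ω Ω-clique (comp Ω u) (comp-avoids Ω u∉Ω)
      open Domination (comp-connected Ω u∉Ω)

  HeavyBelow : Subset n → ℕ → Set
  HeavyBelow Ω f = ∀ u → u ∉ Ω → Heavy (comp Ω u) → ∣ comp Ω u ∣ < f

  improve : ∀ {Ω u} → IsMaximalClique H Ω → u ∉ Ω → Heavy (comp Ω u) →
            ∃ λ Ω′ → IsMaximalClique H Ω′ × HeavyBelow Ω′ ∣ comp Ω u ∣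
  improve {Ω} {u} maxΩ u∉Ω heavy with dominating-vertex (proj₁ maxΩ) u∉Ω
  ... | v , v∈D , v-sees with extend-to-maximal (star Ω v) (star-clique v (proj₁ maxΩ))
  ...   | Ω′ , star⊆Ω′ , maxΩ′ =
          Ω′ , maxΩ′ ,
          Shift.shrinks Ω u v v∈D v-sees Ω′ (star⊆Ω′ (centre∈star Ω v))
                        (λ y∈Ω vy → star⊆Ω′ (leaf∈star y∈Ω vy)) heavy

  -- Improve while a heavy component is left.  Each step lowers the bound on
  -- the size of heavy components, and the bound 0 means Ω is balanced.
  balance : ∀ f Ω → IsMaximalClique H Ω → HeavyBelow Ω f → ∃ λ Ω → IsMaximalClique H Ω × Balanced Ω
  balance zero Ω maxΩ below = Ω , maxΩ , λ u u∉Ω heavy → n≮0 (below u u∉Ω heavy)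
  balance (suc f) Ω maxΩ below = continue (any? (λ u → ¬? (u ∈? Ω) ×-dec heavy? (comp Ω u)))
    where
      continue : Dec (∃ λ u → u ∉ Ω × Heavy (comp Ω u)) → ∃ λ Ω → IsMaximalClique H Ω × Balanced Ω
      continue (no none) = Ω , maxΩ , λ u u∉Ω heavy → none (u , u∉Ω , heavy)
      continue (yes (u , u∉Ω , heavy)) =
        let Ω′ , maxΩ′ , below′ = improve maxΩ u∉Ω heavy
        in balance f Ω′ maxΩ′ (λ u′ u′∉Ω′ heavy′ → <-≤-trans (below′ u′ u′∉Ω′ heavy′) (≤-pred (below u u∉Ω heavy)))

  -- Start from a maximal clique extending the empty one: no component has
  -- more than n vertices.
  balanced-clique : ∃ λ Ω → IsMaximalClique H Ω × Balanced Ω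
  balanced-clique with extend-to-maximal ⊥ (λ _ _ x∈⊥ → contradiction x∈⊥ ∉⊥)
  ... | Ω , _ , maxΩ = balance (suc n) Ω maxΩ (λ u _ _ → s≤s (∣p∣≤n (comp Ω u)))

lemma31 : ∀ {n} (G : Graph n) (𝒲 : List (Subset n)) → IsEdgeCliqueCover G 𝒲 →
    ∀ (H : Graph n) → IsMinimalTriangulation G H →
    ∃[ Ω ] (IsMaximalClique H Ω ×
    (∀ C → IsComponentMinus G Ω C → 2 * length (restrict 𝒲 C) ≤ length 𝒲))
lemma31 G 𝒲 cover H ((chordal , G⊆H) , _) =
  let open Balancing G H 𝒲 cover chordal G⊆H
      Ω , maxΩ , balanced = balanced-clique
  in Ω , maxΩ , balanced-G-components balanced
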